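{- Let $M=p_1^{n_1}\cdots p_K^{n_K}$ with distinct primes and $n_\nu\in\mathbb{N}$, let $A\oplus B=\mathbb{Z}_M$ with $0\in A\cap B$, fix $i$, and let $a\in A$, $b\in B$. Then the following are equivalent: (i) $\gcd(a-\nu M/p_i,M)=\gcd(b-\nu' M/p_i,M)$ for some $\nu,\nu'\in\{0,\dots,p_i-1\}$; (ii) $a+rb=\nu'' M/p_i$ for some $r\in R$ and $\nu''\in\{0,\dots,p_i-1\}$.
   Context: $A\oplus B=\mathbb{Z}_M$ means every element of $\mathbb{Z}_M$ is uniquely $a+b$ with $a\in A,b\in B$. $R=\{r\in\mathbb{Z}_M:\gcd(r,M)=1\}$. (In the paper's terminology, condition (i) says $a\in A_{x,y}$ and $b\in B_{y,x}$ for $x=\nu M/p_i$, $y=\nu'M/p_i$, where $A_{x,y}=\{a\in A:\gcd(x-a,M)=\gcd(y-b,M)\text{ for some }b\in B\}$.) -}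

module Defs where

open import Data.Nat using (ℕ; _+_; _*_; _∸_; _<_; NonZero)
open import Data.Nat.DivMod using (_%_)
open import Data.Nat.GCD using (gcd)
open import Data.Product using (Σ; _×_; ∃; ∃-syntax)
open import Relation.Binary.PropositionalEquality using (_≡_)

-- Elements of ℤ_M are represented by their canonical representatives 0 … M-1.
-- A subset of ℤ_M is a predicate on ℕ holding only for representatives < M.
SubsetZ : ℕ → Set₁
SubsetZ M = Σ (ℕ → Set) λ S → ∀ x → S x → x < M

subM : (M : ℕ) → .{{NonZero M}} → ℕ → ℕ → ℕ
subM M x y = (x + (M ∸ (y % M))) % M

DirectSum : (M : ℕ) → .{{NonZero M}} → (A B : ℕ → Set) → Set
DirectSum M A B =
  (∀ x → x < M → ∃[ a ] ∃[ b ] (A a × B b × (a + b) % M ≡ x)) ×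
  (∀ a b a' b' → A a → B b → A a' → B b' →
     (a + b) % M ≡ (a' + b') % M → a ≡ a' × b ≡ b')

{-# OPTIONS --safe #-}
module Submission where

-- Two residues x, y have the same gcd g with M exactly when x ≡ −u·y (mod M) for a unit u:
-- x/g and y/g are units modulo M/g, so x/g ≡ −s·(y/g) (mod M/g) for a unit s, and every unit
-- modulo M/g lifts to a unit modulo M. For x = a − ν·M/p, y = b − ν'·M/p this gives
-- a + u·b ≡ (ν + u·ν')·M/p, which is (ii). Conversely (ii) with ν = ν'', ν' = 0 says
-- a − ν''·M/p ≡ −r·b, which has the same gcd with M as b.

open import Defs
open import Data.Nat
  using (ℕ; zero; suc; _+_; _*_; _∸_; _<_; NonZero; NonTrivial; ≢-nonZero; ≢-nonZero⁻¹; >-nonZero⁻¹)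
open import Data.Nat.Properties
  using (+-comm; +-assoc; *-identityʳ; *-assoc; *-monoˡ-<; m*n≢0; m*n≢0⇒n≢0; m+[n∸m]≡n; m∸n+n≡m)
open import Data.Nat.DivMod
  using (_%_; _/_; m%n<n; m%n≤n; m%n%n≡m%n; %-distribˡ-+; %-distribˡ-*; %-remove-+ˡ; [m+n]%n≡m%n;
         m<n⇒m%n≡m; n%n≡0; /-congʳ; m/n*n≡m; m%n*o≡m*o%[n*o])
open import Data.Nat.Divisibility
  using (_∣_; divides; ∣-trans; ∣-antisym; ∣1⇒≡1; ∣m+n∣m⇒∣n; ∣m∣n⇒∣m+n; ∣m⇒∣m*n; ∣n⇒∣m*n; m∣m*n;
         n∣m*n*o; *-monoˡ-∣; quotient; quotient≢0; quotient-<; m∣n⇒n≡quotient*m; m%n≡0⇒n∣m; ∣n∣m%n⇒∣m)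
open import Data.Nat.Coprimality as Coprime
  using (Coprime; coprime?; coprime-divisor; coprime-Bézout; coprime-+; coprime-/gcd; 1-coprimeTo;
         gcd≡1⇒coprime; coprime⇒gcd≡1)
open import Data.Nat.GCD
  using (gcd; gcd[m,n]∣m; gcd[m,n]∣n; gcd-greatest; gcd[m,n]≢0; n/gcd[m,n]≢0; module Bézout)
open import Data.Nat.Induction using (<-rec)
open import Data.Nat.Primality using (Prime; prime⇒nonZero)
open import Data.Nat.Tactic.RingSolver using (solve-∀)
open import Data.Product using (Σ-syntax; _×_; _,_; proj₁; proj₂; ∃-syntax; ∃₂)
open import Data.Sum using (inj₁; inj₂)
open import Function using (_∘_)
open import Function.Bundles using (_⇔_; mk⇔)
open import Relation.Binary.PropositionalEquality
  using (_≡_; _≢_; refl; sym; trans; cong; cong₂; subst; subst₂; module ≡-Reasoning)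
open import Relation.Nullary using (yes; no; contradiction)

private variable
  a a' b b' c r s w x y N M X Y : ℕ

coprime-*ˡ : Coprime a c → Coprime b c → Coprime (a * b) c
coprime-*ˡ a⊥c b⊥c {e} (e∣ab , e∣c) = b⊥c (coprime-divisor e⊥a e∣ab , e∣c)
  where
  e⊥a : Coprime e _
  e⊥a (f∣e , f∣a) = a⊥c (f∣a , ∣-trans f∣e e∣c)

coprime-*ʳ : Coprime c a → Coprime c b → Coprime c (a * b)
coprime-*ʳ c⊥a c⊥b = Coprime.sym (coprime-*ˡ (Coprime.sym c⊥a) (Coprime.sym c⊥b))

coprime-+-∣ : c ∣ w → Coprime s c → Coprime (s + w) c
coprime-+-∣ {w = w} {s} c∣w s⊥c {e} (e∣s+w , e∣c) =
  s⊥c (∣m+n∣m⇒∣n (subst (e ∣_) (+-comm s w) e∣s+w) (∣-trans e∣c c∣w) , e∣c)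

≢0∧≢1⇒nonTrivial : ∀ {n} → n ≢ 0 → n ≢ 1 → NonTrivial n
≢0∧≢1⇒nonTrivial {zero}        n≢0 _   = contradiction refl n≢0
≢0∧≢1⇒nonTrivial {suc zero}    _   n≢1 = contradiction refl n≢1
≢0∧≢1⇒nonTrivial {suc (suc _)} _   _   = _

-- rad d ∣ s, phrased without primes.
RadicalDivides : ℕ → ℕ → Set
RadicalDivides d s = ∀ {w} → Coprime w s → Coprime w d

CoprimeRadicalSplit : ℕ → ℕ → Set
CoprimeRadicalSplit s c = ∃₂ λ c' d → c ≡ c' * d × Coprime c' s × RadicalDivides d s

coprimeRadicalSplit-*-∣ : ∀ {g} → g ∣ s → CoprimeRadicalSplit s c → CoprimeRadicalSplit s (c * g)
coprimeRadicalSplit-*-∣ {g = g} g∣s (c' , d , c≡c'd , c'⊥s , rad) =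
  c' , d * g , trans (cong (_* g) c≡c'd) (*-assoc c' d g) , c'⊥s ,
  λ w⊥s → coprime-*ʳ (rad w⊥s) (λ (e∣w , e∣g) → w⊥s (e∣w , ∣-trans e∣g g∣s))

coprimeRadicalSplit : ∀ s c → .{{NonZero c}} → CoprimeRadicalSplit s c
coprimeRadicalSplit s c = <-rec (λ c → c ≢ 0 → CoprimeRadicalSplit s c) split c (≢-nonZero⁻¹ c)
  where
  split : ∀ c → (∀ {q} → q < c → q ≢ 0 → CoprimeRadicalSplit s q) → c ≢ 0 → CoprimeRadicalSplit s c
  split c rec c≢0 with coprime? c s
  ... | yes c⊥s = c , 1 , sym (*-identityʳ c) , c⊥s , λ _ → Coprime.sym (1-coprimeTo _)
  ... | no ¬c⊥s = subst (CoprimeRadicalSplit s) (sym (m∣n⇒n≡quotient*m g∣c))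
                    (coprimeRadicalSplit-*-∣ (gcd[m,n]∣n c s) (rec (quotient-< g∣c) q≢0))
    where
    g∣c = gcd[m,n]∣m c s
    instance
      _ : NonZero c
      _ = ≢-nonZero c≢0
      _ : NonTrivial (gcd c s)
      _ = ≢0∧≢1⇒nonTrivial (gcd[m,n]≢0 c s (inj₁ c≢0)) (¬c⊥s ∘ gcd≡1⇒coprime)
    q≢0 : quotient g∣c ≢ 0
    q≢0 = ≢-nonZero⁻¹ _ {{quotient≢0 g∣c}}

-- For M = c·d with c coprime to s and rad d ∣ s, the number s + c·N is coprime to c because
-- s is, and coprime to s (hence to d) because c and N are.
coprime-lift : ∀ M .{{_ : NonZero M}} → Coprime s N → ∃[ k ] Coprime (s + k * N) M
coprime-lift {s} {N} M s⊥N with coprimeRadicalSplit s M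
... | c , d , M≡cd , c⊥s , rad = c , subst (Coprime u) (sym M≡cd) (coprime-*ʳ u⊥c (rad u⊥s))
  where
  u = s + c * N
  u⊥c : Coprime u c
  u⊥c = coprime-+-∣ (m∣m*n N) (Coprime.sym c⊥s)
  u⊥s : Coprime u s
  u⊥s = coprime-+ (coprime-*ˡ c⊥s (Coprime.sym s⊥N))

coprime⇒∃negInverse : ∀ N .{{_ : NonZero N}} → Coprime Y N → ∃[ w ] N ∣ 1 + w * Y
coprime⇒∃negInverse {Y} (suc n) Y⊥N with coprime-Bézout Y⊥N
... | Bézout.-+ x q 1+xY≡qN = x , divides q 1+xY≡qN
-- Here x inverts Y modulo N = 1 + n, so x·n ≡ −x is a negative inverse.
... | Bézout.+- x q 1+qN≡xY = x * n , divides (1 + n * q) (begin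
      1 + x * n * Y            ≡⟨ cong (1 +_) (xnY≡n[xY] x n Y) ⟩
      1 + n * (x * Y)          ≡⟨ cong (λ t → 1 + n * t) 1+qN≡xY ⟨
      1 + n * (1 + q * suc n)  ≡⟨ 1+n[1+qN]≡[1+nq]N n q ⟩
      (1 + n * q) * suc n      ∎)
  where
  open ≡-Reasoning
  xnY≡n[xY] : ∀ x n Y → x * n * Y ≡ n * (x * Y)
  xnY≡n[xY] = solve-∀
  1+n[1+qN]≡[1+nq]N : ∀ n q → 1 + n * (1 + q * suc n) ≡ (1 + n * q) * suc n
  1+n[1+qN]≡[1+nq]N = solve-∀

∣1+*⇒coprime : N ∣ 1 + w * Y → Coprime w N
∣1+*⇒coprime {w = w} {Y} N∣1+wY {e} (e∣w , e∣N) =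
  ∣1⇒≡1 (∣m+n∣m⇒∣n (subst (e ∣_) (+-comm 1 (w * Y)) (∣-trans e∣N N∣1+wY)) (∣m⇒∣m*n Y e∣w))

-- x ≡ −u·y (mod M) for a unit u, i.e. x and y are associates in ℤ_M (−1 being a unit);
-- stated this way so that no subtraction occurs.
Associated : ℕ → ℕ → ℕ → Set
Associated M x y = ∃[ u ] Coprime u M × M ∣ x + u * y

coprime⇒associated : ∀ N .{{_ : NonZero N}} → Coprime X N → Coprime Y N → Associated N X Y
coprime⇒associated {X} {Y} N X⊥N Y⊥N with coprime⇒∃negInverse N Y⊥N
... | w , N∣1+wY =
  X * w , coprime-*ˡ X⊥N (∣1+*⇒coprime N∣1+wY) , subst (N ∣_) (X[1+wY]≡X+XwY X w Y) (∣n⇒∣m*n X N∣1+wY)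
  where
  X[1+wY]≡X+XwY : ∀ X w Y → X * (1 + w * Y) ≡ X + X * w * Y
  X[1+wY]≡X+XwY = solve-∀

associated-* : ∀ N g .{{_ : NonZero (N * g)}} → Associated N X Y → Associated (N * g) (X * g) (Y * g)
associated-* {X} {Y} N g (s , s⊥N , N∣X+sY) with coprime-lift (N * g) s⊥N
... | k , u⊥Ng = s + k * N , u⊥Ng , subst (N * g ∣_) ([X+uY]g≡Xg+uYg X (s + k * N) Y g) (*-monoˡ-∣ g N∣X+uY)
  where
  X+sY+kNY≡X+[s+kN]Y : ∀ X s k N Y → X + s * Y + k * N * Y ≡ X + (s + k * N) * Y
  X+sY+kNY≡X+[s+kN]Y = solve-∀
  [X+uY]g≡Xg+uYg : ∀ X u Y g → (X + u * Y) * g ≡ X * g + u * (Y * g)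
  [X+uY]g≡Xg+uYg = solve-∀
  N∣X+uY : N ∣ X + (s + k * N) * Y
  N∣X+uY = subst (N ∣_) (X+sY+kNY≡X+[s+kN]Y X s k N Y) (∣m∣n⇒∣m+n N∣X+sY (n∣m*n*o k Y))

gcd≡⇒associated : ∀ M .{{_ : NonZero M}} x y → gcd x M ≡ gcd y M → Associated M x y
gcd≡⇒associated M x y gx≡gy =
  subst (λ K → Associated K x y) (m/n*n≡m g∣M)
    (subst₂ (Associated (M / g * g)) (m/n*n≡m g∣x) (m/n*n≡m g∣y)
      (associated-* (M / g) g (coprime⇒associated (M / g) (coprime-/gcd x M) y/g⊥M/g)))
  where
  g = gcd x M
  instance
    _ : NonZero g
    _ = ≢-nonZero (gcd[m,n]≢0 x M (inj₂ (≢-nonZero⁻¹ M)))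
    _ : NonZero (gcd y M)
    _ = ≢-nonZero (gcd[m,n]≢0 y M (inj₂ (≢-nonZero⁻¹ M)))
    _ : NonZero (M / g)
    _ = ≢-nonZero (n/gcd[m,n]≢0 x M)
    _ : NonZero (M / g * g)
    _ = m*n≢0 (M / g) g
  g∣x = gcd[m,n]∣m x M
  g∣M = gcd[m,n]∣n x M
  g∣y = subst (_∣ y) (sym gx≡gy) (gcd[m,n]∣m y M)
  y/g⊥M/g : Coprime (y / g) (M / g)
  y/g⊥M/g = subst₂ Coprime (/-congʳ (sym gx≡gy)) (/-congʳ (sym gx≡gy)) (coprime-/gcd y M)

associated⇒gcd≡ : Associated M x y → gcd x M ≡ gcd y M
associated⇒gcd≡ {M} {x} {y} (u , u⊥M , M∣x+uy) = ∣-antisym gx∣gy gy∣gx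
  where
  gx∣gy : gcd x M ∣ gcd y M
  gx∣gy = gcd-greatest (coprime-divisor gx⊥u gx∣uy) (gcd[m,n]∣n x M)
    where
    gx∣uy = ∣m+n∣m⇒∣n (∣-trans (gcd[m,n]∣n x M) M∣x+uy) (gcd[m,n]∣m x M)
    gx⊥u : Coprime (gcd x M) u
    gx⊥u (e∣gx , e∣u) = u⊥M (e∣u , ∣-trans e∣gx (gcd[m,n]∣n x M))
  gy∣gx : gcd y M ∣ gcd x M
  gy∣gx = gcd-greatest gy∣x (gcd[m,n]∣n y M)
    where
    gy∣x = ∣m+n∣m⇒∣n (subst (gcd y M ∣_) (+-comm x (u * y)) (∣-trans (gcd[m,n]∣n y M) M∣x+uy))
                     (∣n⇒∣m*n u (gcd[m,n]∣m y M))

module Modular (M : ℕ) .{{_ : NonZero M}} where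

  infix 4 _≈_
  _≈_ : ℕ → ℕ → Set
  x ≈ y = x % M ≡ y % M

  %-≈ : ∀ x → x % M ≈ x
  %-≈ x = m%n%n≡m%n x M

  +-≈ : a ≈ a' → b ≈ b' → a + b ≈ a' + b'
  +-≈ {a} {a'} {b} {b'} a≈a' b≈b' = begin
    (a + b) % M            ≡⟨ %-distribˡ-+ a b M ⟩
    (a % M + b % M) % M    ≡⟨ cong₂ (λ s t → (s + t) % M) a≈a' b≈b' ⟩
    (a' % M + b' % M) % M  ≡⟨ %-distribˡ-+ a' b' M ⟨
    (a' + b') % M          ∎
    where open ≡-Reasoning

  *-≈ : a ≈ a' → b ≈ b' → a * b ≈ a' * b'
  *-≈ {a} {a'} {b} {b'} a≈a' b≈b' = begin
    (a * b) % M              ≡⟨ %-distribˡ-* a b M ⟩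
    (a % M * (b % M)) % M    ≡⟨ cong₂ (λ s t → (s * t) % M) a≈a' b≈b' ⟩
    (a' % M * (b' % M)) % M  ≡⟨ %-distribˡ-* a' b' M ⟨
    (a' * b') % M            ∎
    where open ≡-Reasoning

  coprime-% : Coprime a M → Coprime (a % M) M
  coprime-% a⊥M (e∣a%M , e∣M) = a⊥M (∣n∣m%n⇒∣m e∣M e∣a%M , e∣M)

  subM-+-≈ : ∀ a c → subM M a c + c ≈ a
  subM-+-≈ a c = begin
    (subM M a c + c) % M               ≡⟨ +-≈ (%-≈ (a + (M ∸ c % M))) (sym (%-≈ c)) ⟩
    (a + (M ∸ c % M) + c % M) % M      ≡⟨ cong (_% M) (+-assoc a (M ∸ c % M) (c % M)) ⟩
    (a + (M ∸ c % M + c % M)) % M      ≡⟨ cong (λ t → (a + t) % M) (m∸n+n≡m (m%n≤n c M)) ⟩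
    (a + M) % M                        ≡⟨ [m+n]%n≡m%n a M ⟩
    a % M                              ∎
    where open ≡-Reasoning

  ≈⇒∣subM-+ : a + w ≈ c → M ∣ subM M a c + w
  ≈⇒∣subM-+ {a} {w} {c} a+w≈c = m%n≡0⇒n∣m (subM M a c + w) M (begin
    (subM M a c + w) % M            ≡⟨ +-≈ (%-≈ (a + (M ∸ c % M))) refl ⟩
    (a + (M ∸ c % M) + w) % M       ≡⟨ cong (_% M) (x+y+z≡x+z+y a (M ∸ c % M) w) ⟩
    (a + w + (M ∸ c % M)) % M       ≡⟨ +-≈ (trans a+w≈c (sym (%-≈ c))) refl ⟩
    (c % M + (M ∸ c % M)) % M       ≡⟨ cong (_% M) (m+[n∸m]≡n (m%n≤n c M)) ⟩
    M % M                           ≡⟨ n%n≡0 M ⟩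
    0                               ∎)
    where
    open ≡-Reasoning
    x+y+z≡x+z+y : ∀ x y z → x + y + z ≡ x + z + y
    x+y+z≡x+z+y = solve-∀

  subM-identityʳ : b < M → subM M b 0 ≡ b
  subM-identityʳ {b} b<M = begin
    (b + (M ∸ 0 % M)) % M  ≡⟨ cong (λ t → (b + (M ∸ t)) % M) (m<n⇒m%n≡m (>-nonZero⁻¹ M)) ⟩
    (b + M) % M            ≡⟨ [m+n]%n≡m%n b M ⟩
    b % M                  ≡⟨ m<n⇒m%n≡m b<M ⟩
    b                      ∎
    where open ≡-Reasoning

  associated[a-c,b-c']⇒a+ub≈c+uc' : ∀ a b c c' → Associated M (subM M a c) (subM M b c') →
    ∃[ u ] Coprime u M × a + u * b ≈ c + u * c'
  associated[a-c,b-c']⇒a+ub≈c+uc' a b c c' (u , u⊥M , M∣a-c+u[b-c']) = u , u⊥M , (begin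
    (a + u * b) % M                         ≡⟨ +-≈ (subM-+-≈ a c) (*-≈ {u} refl (subM-+-≈ b c')) ⟨
    (a-c + c + u * (b-c' + c')) % M         ≡⟨ cong (_% M) (rearrange a-c c u b-c' c') ⟩
    (a-c + u * b-c' + (c + u * c')) % M     ≡⟨ %-remove-+ˡ (c + u * c') M∣a-c+u[b-c'] ⟩
    (c + u * c') % M                        ∎)
    where
    open ≡-Reasoning
    a-c = subM M a c
    b-c' = subM M b c'
    rearrange : ∀ x c u y c' → x + c + u * (y + c') ≡ x + u * y + (c + u * c')
    rearrange = solve-∀

  a+rb≈c⇒gcd[a-c]≡gcd[b] : ∀ a b c → Coprime r M → a + r * b ≈ c → gcd (subM M a c) M ≡ gcd b M
  a+rb≈c⇒gcd[a-c]≡gcd[b] {r} a b c r⊥M a+rb≈c = associated⇒gcd≡ (r , r⊥M , ≈⇒∣subM-+ a+rb≈c)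

a+ub≡νm+uν'm⇒∃a+rb≡multiple : ∀ p m .{{_ : NonZero p}} .{{_ : NonZero (p * m)}} a b ν ν' →
  (∃[ u ] Coprime u (p * m) × (a + u * b) % (p * m) ≡ (ν * m + u * (ν' * m)) % (p * m)) →
  Σ[ r ∈ ℕ ] Σ[ ν'' ∈ ℕ ] (r < p * m × gcd r (p * m) ≡ 1 × ν'' < p × (a + r * b) % (p * m) ≡ ν'' * m)
-- The arguments of coprime⇒gcd≡1 and gcd≡1⇒coprime are explicit because solving them by
-- unification makes Agda normalise gcd on open terms, which does not terminate in practice.
a+ub≡νm+uν'm⇒∃a+rb≡multiple p m a b ν ν' (u , u⊥M , a+ub≈) =
  u % (p * m) , k % p , m%n<n u (p * m) , coprime⇒gcd≡1 {u % (p * m)} {p * m} (coprime-% u⊥M) , m%n<n k p ,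
  (begin
    (a + u % (p * m) * b) % (p * m)     ≡⟨ +-≈ {a} refl (*-≈ (%-≈ u) refl) ⟩
    (a + u * b) % (p * m)               ≡⟨ a+ub≈ ⟩
    (ν * m + u * (ν' * m)) % (p * m)    ≡⟨ cong (_% (p * m)) (νm+u[ν'm]≡[ν+uν']m ν m u ν') ⟩
    k * m % (p * m)                     ≡⟨ m%n*o≡m*o%[n*o] k p m ⟨
    k % p * m                           ∎)
  where
  open ≡-Reasoning
  open Modular (p * m)
  k = ν + u * ν'
  νm+u[ν'm]≡[ν+uν']m : ∀ ν m u ν' → ν * m + u * (ν' * m) ≡ (ν + u * ν') * m
  νm+u[ν'm]≡[ν+uν']m = solve-∀

a+rb≡multiple⇒gcd-shifts≡ : ∀ p m .{{_ : NonZero (p * m)}} a b r ν'' → b < p * m → ν'' < p →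
  gcd r (p * m) ≡ 1 → (a + r * b) % (p * m) ≡ ν'' * m →
  gcd (subM (p * m) a (ν'' * m)) (p * m) ≡ gcd (subM (p * m) b (0 * m)) (p * m)
a+rb≡multiple⇒gcd-shifts≡ p m a b r ν'' b<M ν''<p gcd[r,M]≡1 a+rb≡ν''m = begin
  gcd (subM (p * m) a (ν'' * m)) (p * m)  ≡⟨ a+rb≈c⇒gcd[a-c]≡gcd[b] a b (ν'' * m) r⊥M a+rb≈ν''m ⟩
  gcd b (p * m)                           ≡⟨ cong (λ t → gcd t (p * m)) (subM-identityʳ b<M) ⟨
  gcd (subM (p * m) b (0 * m)) (p * m)    ∎
  where
  open ≡-Reasoning
  open Modular (p * m)
  instance _ = m*n≢0⇒n≢0 p
  r⊥M = gcd≡1⇒coprime {r} {p * m} gcd[r,M]≡1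
  a+rb≈ν''m = trans a+rb≡ν''m (sym (m<n⇒m%n≡m (*-monoˡ-< m ν''<p)))

lemma4p5 : (M : ℕ) → .{{_ : NonZero M}} → (p m : ℕ) → Prime p → M ≡ p * m →
    (A B : SubsetZ M) → DirectSum M (proj₁ A) (proj₁ B) →
    proj₁ A 0 → proj₁ B 0 →
    (a b : ℕ) → proj₁ A a → proj₁ B b →
    ((Σ[ ν ∈ ℕ ] Σ[ ν' ∈ ℕ ] (ν < p × ν' < p ×
        gcd (subM M a (ν * m)) M ≡ gcd (subM M b (ν' * m)) M))
     ⇔
     (Σ[ r ∈ ℕ ] Σ[ ν'' ∈ ℕ ] (r < M × gcd r M ≡ 1 × ν'' < p ×
        (a + r * b) % M ≡ ν'' * m)))
lemma4p5 .(p * m) p m p-prime refl _ B _ _ _ a b _ b∈B = mk⇔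
  (λ (ν , ν' , _ , _ , gcd≡) →
    a+ub≡νm+uν'm⇒∃a+rb≡multiple p m a b ν ν' (associated[a-c,b-c']⇒a+ub≈c+uc' a b (ν * m) (ν' * m)
      (gcd≡⇒associated (p * m) (subM (p * m) a (ν * m)) (subM (p * m) b (ν' * m)) gcd≡)))
  (λ (r , ν'' , _ , gcd[r,M]≡1 , ν''<p , a+rb≡ν''m) →
    ν'' , 0 , ν''<p , >-nonZero⁻¹ p ,
    a+rb≡multiple⇒gcd-shifts≡ p m a b r ν'' (proj₂ B b b∈B) ν''<p gcd[r,M]≡1 a+rb≡ν''m)
  where
  open Modular (p * m)
  instance _ = prime⇒nonZero p-prime
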